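{- Let $\varphi$ and $\psi$ be expressions in the variables $x_1,\ldots,x_n$ that are $\mathrm{B}_2$-equivalent, i.e. $\llbracket\varphi\rrbracket_v=\llbracket\psi\rrbracket_v$ for every valuation $v$ in the two-element Boolean algebra. Then $\llbracket\mathcal{M}(\varphi)_{imp}\rrbracket_v=\llbracket\mathcal{M}(\psi)_{imp}\rrbracket_v$ for every valuation $v$ of $x_1,\ldots,x_n$ in $\mathrm{M}$ for which $\llbracket\varphi\rrbracket_v<0$ (equivalently, $\llbracket\psi\rrbracket_v<0$).
   Context: $\mathrm{M}$ denotes $\widehat{\mathbb{Z}}=(\mathbb{Z}\setminus\{0\})\cup\{ -\infty,\infty\}$ with $\land=\min$, $\lor=\max$, $\lnot a=-a$. An expression is a propositional formula built from variables with $\land,\lor,\lnot$ (no constants); a valuation $v$ assigns each variable a value in $\mathrm{M}$ and $\llbracket\varphi\rrbracket_v$ is the resulting value. A literal is a variable $x$ or its negation $\bar x$; a (conjunctive) term is a conjunction of literals, identified with its set of literals, and a subterm is a term whose literals form a subset. The De Morgan Canonical Form $\mathcal{M}(\varphi)$ is the unique (up to reordering) expression obtained from $\varphi$ using only the laws of De Morgan algebras (commutativity, associativity, idempotence, absorption, distributivity, double negation, De Morgan laws) which is in disjunctive normal form, in which no term contains the same literal twice, and no term is a subterm of another. $\mathcal{M}(\varphi)_{imp}$ is the disjunction of those terms of $\mathcal{M}(\varphi)$ containing no pair $x,\bar x$, and $\mathcal{M}(\varphi)_{cont}$ the disjunction of the remaining (contradictory) terms. -}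

module Defs where

open import Data.Bool using (Bool; true; false; _∧_; _∨_; not; if_then_else_)
open import Data.Nat using (ℕ; zero; suc)
open import Data.Fin using (Fin; _≟_)
open import Data.List using (List; []; _∷_; _++_; map; concatMap; foldr)
open import Data.Product using (_×_; _,_; proj₁; proj₂)
open import Relation.Nullary.Decidable using (⌊_⌋)
open import Relation.Binary.PropositionalEquality using (_≡_)

-- The De Morgan algebra M = (ℤ ∖ {0}) ∪ {-∞, +∞}

data M : Set where
  -∞  : M
  neg : ℕ → M      -- neg k  denotes the integer -(k+1)
  pos : ℕ → M      -- pos k  denotes the integer  k+1
  +∞  : M

any : ∀ {A : Set} → (A → Bool) → List A → Bool
any p []       = false
any p (x ∷ xs) = p x ∨ any p xs

all : ∀ {A : Set} → (A → Bool) → List A → Bool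
all p []       = true
all p (x ∷ xs) = p x ∧ all p xs

filter : ∀ {A : Set} → (A → Bool) → List A → List A
filter p []       = []
filter p (x ∷ xs) = if p x then x ∷ filter p xs else filter p xs

_≤ᵇ_ : ℕ → ℕ → Bool
zero  ≤ᵇ _     = true
suc _ ≤ᵇ zero  = false
suc m ≤ᵇ suc n = m ≤ᵇ n

_≤M_ : M → M → Bool
-∞    ≤M _     = true
neg _ ≤M -∞    = false
neg m ≤M neg n = n ≤ᵇ m
neg _ ≤M _     = true
pos _ ≤M -∞    = false
pos _ ≤M neg _ = false
pos m ≤M pos n = m ≤ᵇ n
pos _ ≤M +∞    = true
+∞    ≤M +∞    = true
+∞    ≤M _     = false

minM : M → M → M
minM a b = if a ≤M b then a else b

maxM : M → M → M
maxM a b = if a ≤M b then b else a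

negM : M → M
negM -∞      = +∞
negM (neg k) = pos k
negM (pos k) = neg k
negM +∞      = -∞

IsNeg : M → Set
IsNeg a = (a ≤M neg 0) ≡ true

data Expr (n : ℕ) : Set where
  var  : Fin n → Expr n
  _∧ₑ_ : Expr n → Expr n → Expr n
  _∨ₑ_ : Expr n → Expr n → Expr n
  ¬ₑ_  : Expr n → Expr n

⟦_⟧M : ∀ {n} → Expr n → (Fin n → M) → M
⟦ var x ⟧M v   = v x
⟦ a ∧ₑ b ⟧M v  = minM (⟦ a ⟧M v) (⟦ b ⟧M v)
⟦ a ∨ₑ b ⟧M v  = maxM (⟦ a ⟧M v) (⟦ b ⟧M v)
⟦ ¬ₑ a ⟧M v    = negM (⟦ a ⟧M v)

⟦_⟧B : ∀ {n} → Expr n → (Fin n → Bool) → Bool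
⟦ var x ⟧B v   = v x
⟦ a ∧ₑ b ⟧B v  = ⟦ a ⟧B v ∧ ⟦ b ⟧B v
⟦ a ∨ₑ b ⟧B v  = ⟦ a ⟧B v ∨ ⟦ b ⟧B v
⟦ ¬ₑ a ⟧B v    = not (⟦ a ⟧B v)

B₂-equivalent : ∀ {n} → Expr n → Expr n → Set
B₂-equivalent φ ψ = ∀ (v : Fin _ → Bool) → ⟦ φ ⟧B v ≡ ⟦ ψ ⟧B v

-- (x , true) is the literal x, (x , false) is the literal x̄
Literal : ℕ → Set
Literal n = Fin n × Bool

Term : ℕ → Set
Term n = List (Literal n)

DNF : ℕ → Set
DNF n = List (Term n)

_==B_ : Bool → Bool → Bool
true  ==B b = b
false ==B b = not b

_==L_ : ∀ {n} → Literal n → Literal n → Bool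
(x , p) ==L (y , q) = ⌊ x ≟ y ⌋ ∧ (p ==B q)

memL : ∀ {n} → Literal n → Term n → Bool
memL l t = any (l ==L_) t

dedup : ∀ {n} → Term n → Term n
dedup []      = []
dedup (l ∷ t) = if memL l t then dedup t else l ∷ dedup t

_⊆ᵇ_ : ∀ {n} → Term n → Term n → Bool
t ⊆ᵇ s = all (λ l → memL l s) t

-- disjunctive normal form via the De Morgan algebra laws:
-- dnf⁺ φ is a DNF for φ, dnf⁻ φ is a DNF for ¬φ (De Morgan laws and
-- double negation push negations to the variables; distributivity
-- multiplies out conjunctions).
cross : ∀ {n} → DNF n → DNF n → DNF n
cross d e = concatMap (λ t → map (λ s → t ++ s) e) d

dnf⁺ dnf⁻ : ∀ {n} → Expr n → DNF n
dnf⁺ (var x)  = ((x , true) ∷ []) ∷ []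
dnf⁺ (a ∧ₑ b) = cross (dnf⁺ a) (dnf⁺ b)
dnf⁺ (a ∨ₑ b) = dnf⁺ a ++ dnf⁺ b
dnf⁺ (¬ₑ a)   = dnf⁻ a
dnf⁻ (var x)  = ((x , false) ∷ []) ∷ []
dnf⁻ (a ∧ₑ b) = dnf⁻ a ++ dnf⁻ b
dnf⁻ (a ∨ₑ b) = cross (dnf⁻ a) (dnf⁻ b)
dnf⁻ (¬ₑ a)   = dnf⁺ a

insertAbs : ∀ {n} → Term n → DNF n → DNF n
insertAbs t d =
  if any (λ s → s ⊆ᵇ t) d then d
  else t ∷ filter (λ s → not (t ⊆ᵇ s)) d

absorb : ∀ {n} → DNF n → DNF n
absorb = foldr insertAbs []

canonical : ∀ {n} → Expr n → DNF n
canonical φ = absorb (map dedup (dnf⁺ φ))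

contradictory : ∀ {n} → Term n → Bool
contradictory t = any (λ { (x , p) → memL (x , not p) t }) t

canonicalImp : ∀ {n} → Expr n → DNF n
canonicalImp φ = filter (λ t → not (contradictory t)) (canonical φ)

evalLit : ∀ {n} → Literal n → (Fin n → M) → M
evalLit (x , true)  v = v x
evalLit (x , false) v = negM (v x)

evalTerm : ∀ {n} → Term n → (Fin n → M) → M
evalTerm t v = foldr (λ l r → minM (evalLit l v) r) +∞ t

evalDNF : ∀ {n} → DNF n → (Fin n → M) → M
evalDNF d v = foldr (λ t r → maxM (evalTerm t v) r) -∞ d

module Submission where

-- The sign map a ↦ (0 < a) is a De Morgan homomorphism M → B₂, so the sign
-- of a value of φ is the value of φ under the sign valuation; as 𝓜(φ)_imp is
-- B₂-equivalent to φ, it is negative exactly when φ is.  Now let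
-- a = ⟦𝓜(φ)_imp⟧_v < 0; unless a = -∞, some term t of 𝓜(φ)_imp has value a.
-- The Boolean valuation b with b(x) = false if x̄ ∈ t and b(x) = (a ≤ v x)
-- otherwise satisfies t (t is not contradictory), and since a < 0 every
-- literal true under b has value ≥ a.  So b satisfies 𝓜(ψ)_imp, some term of
-- 𝓜(ψ)_imp has all its literals ≥ a, i.e. ⟦𝓜(ψ)_imp⟧_v ≥ a; by symmetry the
-- values agree.

open import Defs
open import Data.Nat using (ℕ; zero; suc)
open import Data.Fin using (Fin; _≟_)
open import Data.Bool using (Bool; true; false; _∧_; _∨_; not; if_then_else_)
open import Data.Bool.Properties
  using (∨-assoc; ∨-identityʳ; ∨-zeroʳ; ∧-assoc; ∧-identityʳ; ∧-zeroʳ;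
         ∧-distribˡ-∨; ∧-distribʳ-∨; not-involutive; not-injective; not-¬;
         ∨-∧-booleanAlgebra)
open import Algebra.Lattice.Properties.BooleanAlgebra ∨-∧-booleanAlgebra
  using (deMorgan₁; deMorgan₂)
open import Data.List using (List; []; _∷_; _++_; map)
open import Data.List.Membership.Propositional using (_∈_)
open import Data.List.Relation.Unary.Any using (here; there)
open import Data.Product using (_×_; _,_; ∃)
open import Data.Empty using (⊥-elim)
open import Data.Sum using (_⊎_; inj₁; inj₂)
open import Function using (_∘_)
open import Relation.Nullary using (yes; no)
open import Relation.Binary.PropositionalEquality
  using (_≡_; refl; sym; trans; cong; cong₂; module ≡-Reasoning)

open ≡-Reasoning

private
  variable
    n : ℕ
    A : Set

≤ᵇ-refl : ∀ m → (m ≤ᵇ m) ≡ true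
≤ᵇ-refl zero    = refl
≤ᵇ-refl (suc m) = ≤ᵇ-refl m

≤ᵇ-trans : ∀ i j k → (i ≤ᵇ j) ≡ true → (j ≤ᵇ k) ≡ true → (i ≤ᵇ k) ≡ true
≤ᵇ-trans zero    j       k       _ _ = refl
≤ᵇ-trans (suc i) (suc j) (suc k) p q = ≤ᵇ-trans i j k p q

≤ᵇ-total : ∀ i j → (i ≤ᵇ j) ≡ false → (j ≤ᵇ i) ≡ true
≤ᵇ-total (suc i) zero    _ = refl
≤ᵇ-total (suc i) (suc j) p = ≤ᵇ-total i j p

≤ᵇ-antisym : ∀ i j → (i ≤ᵇ j) ≡ true → (j ≤ᵇ i) ≡ true → i ≡ j
≤ᵇ-antisym zero    zero    _ _ = refl
≤ᵇ-antisym (suc i) (suc j) p q = cong suc (≤ᵇ-antisym i j p q)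

≤M-refl : ∀ a → (a ≤M a) ≡ true
≤M-refl -∞      = refl
≤M-refl (neg k) = ≤ᵇ-refl k
≤M-refl (pos k) = ≤ᵇ-refl k
≤M-refl +∞      = refl

≤M-trans : ∀ a b c → (a ≤M b) ≡ true → (b ≤M c) ≡ true → (a ≤M c) ≡ true
≤M-trans -∞      _       _       _ _ = refl
≤M-trans (neg i) (neg j) (neg k) p q = ≤ᵇ-trans k j i q p
≤M-trans (neg i) (neg j) (pos k) _ _ = refl
≤M-trans (neg i) (neg j) +∞      _ _ = refl
≤M-trans (neg i) (pos j) (pos k) _ _ = refl
≤M-trans (neg i) (pos j) +∞      _ _ = refl
≤M-trans (neg i) +∞      +∞      _ _ = refl
≤M-trans (pos i) (pos j) (pos k) p q = ≤ᵇ-trans i j k p q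
≤M-trans (pos i) (pos j) +∞      _ _ = refl
≤M-trans (pos i) +∞      +∞      _ _ = refl
≤M-trans +∞      +∞      +∞      _ _ = refl
≤M-trans (neg i) -∞      _       ()
≤M-trans (neg i) (neg j) -∞      _ ()
≤M-trans (neg i) (pos j) -∞      _ ()
≤M-trans (neg i) (pos j) (neg k) _ ()
≤M-trans (neg i) +∞      -∞      _ ()
≤M-trans (neg i) +∞      (neg k) _ ()
≤M-trans (neg i) +∞      (pos k) _ ()
≤M-trans (pos i) -∞      _       ()
≤M-trans (pos i) (neg j) _       ()
≤M-trans (pos i) (pos j) -∞      _ ()
≤M-trans (pos i) (pos j) (neg k) _ ()
≤M-trans (pos i) +∞      -∞      _ ()
≤M-trans (pos i) +∞      (neg k) _ ()
≤M-trans (pos i) +∞      (pos k) _ ()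
≤M-trans +∞      -∞      _       ()
≤M-trans +∞      (neg j) _       ()
≤M-trans +∞      (pos j) _       ()
≤M-trans +∞      +∞      -∞      _ ()
≤M-trans +∞      +∞      (neg k) _ ()
≤M-trans +∞      +∞      (pos k) _ ()

≤M-total : ∀ a b → (a ≤M b) ≡ false → (b ≤M a) ≡ true
≤M-total (neg i) -∞      _ = refl
≤M-total (neg i) (neg j) p = ≤ᵇ-total j i p
≤M-total (pos i) -∞      _ = refl
≤M-total (pos i) (neg j) _ = refl
≤M-total (pos i) (pos j) p = ≤ᵇ-total i j p
≤M-total +∞      -∞      _ = refl
≤M-total +∞      (neg j) _ = refl
≤M-total +∞      (pos j) _ = refl

≤M-antisym : ∀ a b → (a ≤M b) ≡ true → (b ≤M a) ≡ true → a ≡ b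
≤M-antisym -∞      -∞      _ _ = refl
≤M-antisym (neg i) (neg j) p q = cong neg (≤ᵇ-antisym i j q p)
≤M-antisym (pos i) (pos j) p q = cong pos (≤ᵇ-antisym i j p q)
≤M-antisym +∞      +∞      _ _ = refl
≤M-antisym -∞      (neg j) _ ()
≤M-antisym -∞      (pos j) _ ()
≤M-antisym -∞      +∞      _ ()
≤M-antisym (neg i) -∞      ()
≤M-antisym (neg i) (pos j) _ ()
≤M-antisym (neg i) +∞      _ ()
≤M-antisym (pos i) -∞      ()
≤M-antisym (pos i) (neg j) ()
≤M-antisym (pos i) +∞      _ ()
≤M-antisym +∞      -∞      ()
≤M-antisym +∞      (neg j) ()
≤M-antisym +∞      (pos j) ()

≤M-+∞ : ∀ a → (a ≤M +∞) ≡ true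
≤M-+∞ -∞      = refl
≤M-+∞ (neg k) = refl
≤M-+∞ (pos k) = refl
≤M-+∞ +∞      = refl

≤M--∞⇒≡-∞ : ∀ a → (a ≤M -∞) ≡ true → a ≡ -∞
≤M--∞⇒≡-∞ -∞ _ = refl

≤M-minM : ∀ c a b → (c ≤M minM a b) ≡ ((c ≤M a) ∧ (c ≤M b))
≤M-minM c a b with a ≤M b in a≤b
... | true with c ≤M a in c≤a | c ≤M b in c≤b
...   | true  | true  = refl
...   | true  | false = trans (sym (≤M-trans c a b c≤a a≤b)) c≤b
...   | false | _     = refl
≤M-minM c a b | false with c ≤M a in c≤a | c ≤M b in c≤b
...   | true  | true  = refl
...   | false | true  = trans (sym (≤M-trans c b a c≤b (≤M-total a b a≤b))) c≤a
...   | _     | false = sym (∧-zeroʳ _)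

≤M-maxM : ∀ c a b → (c ≤M maxM a b) ≡ ((c ≤M a) ∨ (c ≤M b))
≤M-maxM c a b with a ≤M b in a≤b
... | true with c ≤M a in c≤a | c ≤M b in c≤b
...   | true  | true  = refl
...   | true  | false = trans (sym c≤b) (≤M-trans c a b c≤a a≤b)
...   | false | _     = refl
≤M-maxM c a b | false with c ≤M a in c≤a | c ≤M b in c≤b
...   | true  | _     = refl
...   | false | true  = trans (sym c≤a) (≤M-trans c b a c≤b (≤M-total a b a≤b))
...   | false | false = refl

≤M-negM : ∀ c a → IsNeg c → (c ≤M a) ≡ false → (c ≤M negM a) ≡ true
≤M-negM (neg i) -∞      _ _ = refl
≤M-negM (neg i) (neg j) _ _ = refl

-- The sign homomorphism M → B₂

sign : M → Bool
sign a = pos 0 ≤M a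

sign-negM : ∀ a → sign (negM a) ≡ not (sign a)
sign-negM -∞      = refl
sign-negM (neg k) = refl
sign-negM (pos k) = refl
sign-negM +∞      = refl

IsNeg⇒sign≡false : ∀ a → IsNeg a → sign a ≡ false
IsNeg⇒sign≡false -∞      _ = refl
IsNeg⇒sign≡false (neg k) _ = refl

sign≡false⇒IsNeg : ∀ a → sign a ≡ false → IsNeg a
sign≡false⇒IsNeg -∞      _ = refl
sign≡false⇒IsNeg (neg k) _ = refl

IsNeg-resp-sign : ∀ a b → sign a ≡ sign b → IsNeg a → IsNeg b
IsNeg-resp-sign a b sa≡sb a<0 = sign≡false⇒IsNeg b (trans (sym sa≡sb) (IsNeg⇒sign≡false a a<0))

sign-⟦⟧ : (e : Expr n) (v : Fin n → M) → sign (⟦ e ⟧M v) ≡ ⟦ e ⟧B (sign ∘ v)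
sign-⟦⟧ (var x)  v = refl
sign-⟦⟧ (a ∧ₑ b) v = trans (≤M-minM (pos 0) (⟦ a ⟧M v) (⟦ b ⟧M v))
                           (cong₂ _∧_ (sign-⟦⟧ a v) (sign-⟦⟧ b v))
sign-⟦⟧ (a ∨ₑ b) v = trans (≤M-maxM (pos 0) (⟦ a ⟧M v) (⟦ b ⟧M v))
                           (cong₂ _∨_ (sign-⟦⟧ a v) (sign-⟦⟧ b v))
sign-⟦⟧ (¬ₑ a)   v = trans (sign-negM (⟦ a ⟧M v)) (cong not (sign-⟦⟧ a v))

any⇒∃∈ : (p : A → Bool) (xs : List A) → any p xs ≡ true → ∃ λ x → x ∈ xs × p x ≡ true
any⇒∃∈ p (x ∷ xs) h with p x in px
... | true  = x , here refl , px
... | false with any⇒∃∈ p xs h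
...   | y , y∈xs , py = y , there y∈xs , py

∈⇒any : (p : A → Bool) {x : A} (xs : List A) → x ∈ xs → p x ≡ true → any p xs ≡ true
∈⇒any p (x ∷ xs) (here refl) px rewrite px = refl
∈⇒any p (y ∷ xs) (there x∈xs) px rewrite ∈⇒any p xs x∈xs px = ∨-zeroʳ (p y)

all⇒∈ : (p : A → Bool) {x : A} (xs : List A) → all p xs ≡ true → x ∈ xs → p x ≡ true
all⇒∈ p (y ∷ xs) h x∈xs with p y in py
all⇒∈ p (y ∷ xs) h (here refl)  | true = py
all⇒∈ p (y ∷ xs) h (there x∈xs) | true = all⇒∈ p xs h x∈xs

∈⇒all : (p : A → Bool) (xs : List A) → (∀ {x} → x ∈ xs → p x ≡ true) → all p xs ≡ true
∈⇒all p []       _ = refl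
∈⇒all p (x ∷ xs) h rewrite h (here refl) = ∈⇒all p xs (h ∘ there)

∧-all-∈ : (p : A → Bool) {x : A} (xs : List A) → x ∈ xs → (p x ∧ all p xs) ≡ all p xs
∧-all-∈ p xs x∈xs with all p xs in h
... | true  rewrite all⇒∈ p xs h x∈xs = refl
... | false = ∧-zeroʳ _

any-++ : (p : A → Bool) (xs ys : List A) → any p (xs ++ ys) ≡ (any p xs ∨ any p ys)
any-++ p []       ys = refl
any-++ p (x ∷ xs) ys = trans (cong (p x ∨_) (any-++ p xs ys)) (sym (∨-assoc (p x) _ _))

all-++ : (p : A → Bool) (xs ys : List A) → all p (xs ++ ys) ≡ (all p xs ∧ all p ys)
all-++ p []       ys = refl
all-++ p (x ∷ xs) ys = trans (cong (p x ∧_) (all-++ p xs ys)) (sym (∧-assoc (p x) _ _))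

∈-filter⇒ : (p : A → Bool) {x : A} (xs : List A) → x ∈ filter p xs → p x ≡ true
∈-filter⇒ p (y ∷ xs) x∈ with p y in py
∈-filter⇒ p (y ∷ xs) (here refl)  | true  = py
∈-filter⇒ p (y ∷ xs) (there x∈)   | true  = ∈-filter⇒ p xs x∈
∈-filter⇒ p (y ∷ xs) x∈           | false = ∈-filter⇒ p xs x∈

any-filter : (p q : A → Bool) (xs : List A) → (∀ x → q x ≡ false → p x ≡ false) →
             any p (filter q xs) ≡ any p xs
any-filter p q []       _ = refl
any-filter p q (x ∷ xs) h with q x in qx
... | true  = cong (p x ∨_) (any-filter p q xs h)
... | false rewrite h x qx = any-filter p q xs h

==L⇒≡ : (l k : Literal n) → (l ==L k) ≡ true → l ≡ k
==L⇒≡ (x , p) (y , q) h with x ≟ y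
==L⇒≡ (x , true)  (.x , true)  _ | yes refl = refl
==L⇒≡ (x , false) (.x , false) _ | yes refl = refl

==L-refl : (l : Literal n) → (l ==L l) ≡ true
==L-refl (x , p) with x ≟ x
==L-refl (x , true)  | yes _ = refl
==L-refl (x , false) | yes _ = refl
... | no x≢x = ⊥-elim (x≢x refl)

memL⇒∈ : (l : Literal n) (t : Term n) → memL l t ≡ true → l ∈ t
memL⇒∈ l t h with any⇒∃∈ (l ==L_) t h
... | k , k∈t , l=k with ==L⇒≡ l k l=k
...   | refl = k∈t

∈⇒memL : {l : Literal n} (t : Term n) → l ∈ t → memL l t ≡ true
∈⇒memL {l = l} t l∈t = ∈⇒any (l ==L_) t l∈t (==L-refl l)

evalLitB : Literal n → (Fin n → Bool) → Bool
evalLitB (x , true)  b = b x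
evalLitB (x , false) b = not (b x)

evalTermB : Term n → (Fin n → Bool) → Bool
evalTermB t b = all (λ l → evalLitB l b) t

evalDNFB : DNF n → (Fin n → Bool) → Bool
evalDNFB d b = any (λ t → evalTermB t b) d

evalLitB-complement : (x : Fin n) (p : Bool) (b : Fin n → Bool) →
                      evalLitB (x , not p) b ≡ not (evalLitB (x , p) b)
evalLitB-complement x true  b = refl
evalLitB-complement x false b = sym (not-involutive (b x))

evalDNFB-map-++ : (t : Term n) (d : DNF n) (b : Fin n → Bool) →
                  evalDNFB (map (t ++_) d) b ≡ (evalTermB t b ∧ evalDNFB d b)
evalDNFB-map-++ t []      b = sym (∧-zeroʳ (evalTermB t b))
evalDNFB-map-++ t (s ∷ d) b = begin
  evalTermB (t ++ s) b ∨ evalDNFB (map (t ++_) d) b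
    ≡⟨ cong₂ _∨_ (all-++ _ t s) (evalDNFB-map-++ t d b) ⟩
  (evalTermB t b ∧ evalTermB s b) ∨ (evalTermB t b ∧ evalDNFB d b)
    ≡⟨ ∧-distribˡ-∨ (evalTermB t b) _ _ ⟨
  evalTermB t b ∧ (evalTermB s b ∨ evalDNFB d b) ∎

evalDNFB-cross : (d e : DNF n) (b : Fin n → Bool) →
                 evalDNFB (cross d e) b ≡ (evalDNFB d b ∧ evalDNFB e b)
evalDNFB-cross []      e b = refl
evalDNFB-cross (t ∷ d) e b = begin
  evalDNFB (map (t ++_) e ++ cross d e) b
    ≡⟨ any-++ _ (map (t ++_) e) (cross d e) ⟩
  evalDNFB (map (t ++_) e) b ∨ evalDNFB (cross d e) b
    ≡⟨ cong₂ _∨_ (evalDNFB-map-++ t e b) (evalDNFB-cross d e b) ⟩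
  (evalTermB t b ∧ evalDNFB e b) ∨ (evalDNFB d b ∧ evalDNFB e b)
    ≡⟨ ∧-distribʳ-∨ (evalDNFB e b) (evalTermB t b) (evalDNFB d b) ⟨
  (evalTermB t b ∨ evalDNFB d b) ∧ evalDNFB e b ∎

evalDNFB-dnf⁺ : (e : Expr n) (b : Fin n → Bool) → evalDNFB (dnf⁺ e) b ≡ ⟦ e ⟧B b
evalDNFB-dnf⁻ : (e : Expr n) (b : Fin n → Bool) → evalDNFB (dnf⁻ e) b ≡ not (⟦ e ⟧B b)

evalDNFB-dnf⁺ (var x)  b = trans (∨-identityʳ _) (∧-identityʳ (b x))
evalDNFB-dnf⁺ (e ∧ₑ f) b = trans (evalDNFB-cross (dnf⁺ e) (dnf⁺ f) b)
                                 (cong₂ _∧_ (evalDNFB-dnf⁺ e b) (evalDNFB-dnf⁺ f b))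
evalDNFB-dnf⁺ (e ∨ₑ f) b = trans (any-++ _ (dnf⁺ e) (dnf⁺ f))
                                 (cong₂ _∨_ (evalDNFB-dnf⁺ e b) (evalDNFB-dnf⁺ f b))
evalDNFB-dnf⁺ (¬ₑ e)   b = evalDNFB-dnf⁻ e b

evalDNFB-dnf⁻ (var x)  b = trans (∨-identityʳ _) (∧-identityʳ (not (b x)))
evalDNFB-dnf⁻ (e ∧ₑ f) b = begin
  evalDNFB (dnf⁻ e ++ dnf⁻ f) b       ≡⟨ any-++ _ (dnf⁻ e) (dnf⁻ f) ⟩
  evalDNFB (dnf⁻ e) b ∨ evalDNFB (dnf⁻ f) b
                                       ≡⟨ cong₂ _∨_ (evalDNFB-dnf⁻ e b) (evalDNFB-dnf⁻ f b) ⟩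
  not (⟦ e ⟧B b) ∨ not (⟦ f ⟧B b)     ≡⟨ deMorgan₁ (⟦ e ⟧B b) (⟦ f ⟧B b) ⟨
  not (⟦ e ⟧B b ∧ ⟦ f ⟧B b)           ∎
evalDNFB-dnf⁻ (e ∨ₑ f) b = begin
  evalDNFB (cross (dnf⁻ e) (dnf⁻ f)) b ≡⟨ evalDNFB-cross (dnf⁻ e) (dnf⁻ f) b ⟩
  evalDNFB (dnf⁻ e) b ∧ evalDNFB (dnf⁻ f) b
                                       ≡⟨ cong₂ _∧_ (evalDNFB-dnf⁻ e b) (evalDNFB-dnf⁻ f b) ⟩
  not (⟦ e ⟧B b) ∧ not (⟦ f ⟧B b)     ≡⟨ deMorgan₂ (⟦ e ⟧B b) (⟦ f ⟧B b) ⟨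
  not (⟦ e ⟧B b ∨ ⟦ f ⟧B b)           ∎
evalDNFB-dnf⁻ (¬ₑ e)   b = trans (evalDNFB-dnf⁺ e b) (sym (not-involutive (⟦ e ⟧B b)))

evalTermB-dedup : (t : Term n) (b : Fin n → Bool) → evalTermB (dedup t) b ≡ evalTermB t b
evalTermB-dedup []      b = refl
evalTermB-dedup (l ∷ t) b with memL l t in l∈t
... | true  = trans (evalTermB-dedup t b) (sym (∧-all-∈ _ t (memL⇒∈ l t l∈t)))
... | false = cong (evalLitB l b ∧_) (evalTermB-dedup t b)

evalDNFB-map-dedup : (d : DNF n) (b : Fin n → Bool) → evalDNFB (map dedup d) b ≡ evalDNFB d b
evalDNFB-map-dedup []      b = refl
evalDNFB-map-dedup (t ∷ d) b = cong₂ _∨_ (evalTermB-dedup t b) (evalDNFB-map-dedup d b)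

evalTermB-⊆ᵇ : (s t : Term n) (b : Fin n → Bool) →
               (s ⊆ᵇ t) ≡ true → evalTermB t b ≡ true → evalTermB s b ≡ true
evalTermB-⊆ᵇ s t b s⊆t t-true = ∈⇒all _ s λ {l} l∈s →
  all⇒∈ _ t t-true (memL⇒∈ l t (all⇒∈ (λ k → memL k t) s s⊆t l∈s))

evalDNFB-insertAbs : (t : Term n) (d : DNF n) (b : Fin n → Bool) →
                     evalDNFB (insertAbs t d) b ≡ (evalTermB t b ∨ evalDNFB d b)
evalDNFB-insertAbs t d b with any (_⊆ᵇ t) d in absorbed | evalTermB t b in t-val
... | true  | false = refl
... | true  | true  with any⇒∃∈ (_⊆ᵇ t) d absorbed
...   | s , s∈d , s⊆t = ∈⇒any _ d s∈d (evalTermB-⊆ᵇ s t b s⊆t t-val)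
evalDNFB-insertAbs t d b | false | true  rewrite t-val = refl
evalDNFB-insertAbs t d b | false | false rewrite t-val = any-filter _ _ d dropped-false
  where
  dropped-false : ∀ s → not (t ⊆ᵇ s) ≡ false → evalTermB s b ≡ false
  dropped-false s t⊆s with evalTermB s b in s-val
  ... | true  = trans (sym (evalTermB-⊆ᵇ t s b (not-injective t⊆s) s-val)) t-val
  ... | false = refl

evalDNFB-absorb : (d : DNF n) (b : Fin n → Bool) → evalDNFB (absorb d) b ≡ evalDNFB d b
evalDNFB-absorb []      b = refl
evalDNFB-absorb (t ∷ d) b =
  trans (evalDNFB-insertAbs t (absorb d) b) (cong (evalTermB t b ∨_) (evalDNFB-absorb d b))

contradictory⇒evalTermB≡false : (t : Term n) (b : Fin n → Bool) →
                                contradictory t ≡ true → evalTermB t b ≡ false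
contradictory⇒evalTermB≡false t b clash with evalTermB t b in t-val
... | false = refl
... | true with any⇒∃∈ _ t clash
...   | (x , p) , xp∈t , x¬p∈t =
  trans (sym (all⇒∈ _ t t-val (memL⇒∈ (x , not p) t x¬p∈t)))
        (trans (evalLitB-complement x p b) (cong not (all⇒∈ _ t t-val xp∈t)))

evalDNFB-canonicalImp : (φ : Expr n) (b : Fin n → Bool) → evalDNFB (canonicalImp φ) b ≡ ⟦ φ ⟧B b
evalDNFB-canonicalImp φ b = begin
  evalDNFB (canonicalImp φ) b
    ≡⟨ any-filter _ _ (canonical φ) (λ t → contradictory⇒evalTermB≡false t b ∘ not-injective) ⟩
  evalDNFB (absorb (map dedup (dnf⁺ φ))) b  ≡⟨ evalDNFB-absorb (map dedup (dnf⁺ φ)) b ⟩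
  evalDNFB (map dedup (dnf⁺ φ)) b           ≡⟨ evalDNFB-map-dedup (dnf⁺ φ) b ⟩
  evalDNFB (dnf⁺ φ) b                       ≡⟨ evalDNFB-dnf⁺ φ b ⟩
  ⟦ φ ⟧B b                                  ∎

sign-evalLit : (l : Literal n) (v : Fin n → M) → sign (evalLit l v) ≡ evalLitB l (sign ∘ v)
sign-evalLit (x , true)  v = refl
sign-evalLit (x , false) v = sign-negM (v x)

sign-evalTerm : (t : Term n) (v : Fin n → M) → sign (evalTerm t v) ≡ evalTermB t (sign ∘ v)
sign-evalTerm []      v = refl
sign-evalTerm (l ∷ t) v = trans (≤M-minM (pos 0) (evalLit l v) (evalTerm t v))
                                (cong₂ _∧_ (sign-evalLit l v) (sign-evalTerm t v))

sign-evalDNF : (d : DNF n) (v : Fin n → M) → sign (evalDNF d v) ≡ evalDNFB d (sign ∘ v)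
sign-evalDNF []      v = refl
sign-evalDNF (t ∷ d) v = trans (≤M-maxM (pos 0) (evalTerm t v) (evalDNF d v))
                               (cong₂ _∨_ (sign-evalTerm t v) (sign-evalDNF d v))

≤M-evalTerm : (c : M) (t : Term n) (v : Fin n → M) →
              (c ≤M evalTerm t v) ≡ all (λ l → c ≤M evalLit l v) t
≤M-evalTerm c []      v = ≤M-+∞ c
≤M-evalTerm c (l ∷ t) v =
  trans (≤M-minM c (evalLit l v) (evalTerm t v))
        (cong (c ≤M evalLit l v ∧_) (≤M-evalTerm c t v))

≤M-evalDNF : (c : M) (d : DNF n) (v : Fin n → M) →
             (c ≤M evalDNF d v) ≡ (any (λ t → c ≤M evalTerm t v) d ∨ (c ≤M -∞))
≤M-evalDNF c []      v = refl
≤M-evalDNF c (t ∷ d) v = begin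
  c ≤M maxM (evalTerm t v) (evalDNF d v)
    ≡⟨ ≤M-maxM c (evalTerm t v) (evalDNF d v) ⟩
  (c ≤M evalTerm t v) ∨ (c ≤M evalDNF d v)
    ≡⟨ cong (c ≤M evalTerm t v ∨_) (≤M-evalDNF c d v) ⟩
  (c ≤M evalTerm t v) ∨ (any (λ s → c ≤M evalTerm s v) d ∨ (c ≤M -∞))
    ≡⟨ ∨-assoc (c ≤M evalTerm t v) _ _ ⟨
  ((c ≤M evalTerm t v) ∨ any (λ s → c ≤M evalTerm s v) d) ∨ (c ≤M -∞) ∎

LiteralsAbove : M → (Fin n → M) → (Fin n → Bool) → Set
LiteralsAbove c v b = ∀ l → evalLitB l b ≡ true → (c ≤M evalLit l v) ≡ true

evalDNFB⇒≤M-evalDNF : (c : M) (d : DNF n) (v : Fin n → M) (b : Fin n → Bool) →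
                      LiteralsAbove c v b → evalDNFB d b ≡ true → (c ≤M evalDNF d v) ≡ true
evalDNFB⇒≤M-evalDNF c d v b above d-true with any⇒∃∈ _ d d-true
... | s , s∈d , s-true =
  trans (≤M-evalDNF c d v) (cong (_∨ (c ≤M -∞)) (∈⇒any _ d s∈d c≤s))
  where
  c≤s : (c ≤M evalTerm s v) ≡ true
  c≤s = trans (≤M-evalTerm c s v) (∈⇒all _ s λ {l} l∈s → above l (all⇒∈ _ s s-true l∈s))

≤M-evalTerm⇒≤M-evalLit : (c : M) (t : Term n) (v : Fin n → M) {l : Literal n} →
                         (c ≤M evalTerm t v) ≡ true → l ∈ t → (c ≤M evalLit l v) ≡ true
≤M-evalTerm⇒≤M-evalLit c t v c≤t = all⇒∈ _ t (trans (sym (≤M-evalTerm c t v)) c≤t)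

cutValuation : Term n → M → (Fin n → M) → Fin n → Bool
cutValuation t c v x = if memL (x , false) t then false else c ≤M v x

cutValuation-literalsAbove : (t : Term n) (c : M) (v : Fin n → M) → IsNeg c →
                             (c ≤M evalTerm t v) ≡ true → LiteralsAbove c v (cutValuation t c v)
cutValuation-literalsAbove t c v c<0 c≤t (x , true) h with memL (x , false) t
... | false = h
cutValuation-literalsAbove t c v c<0 c≤t (x , false) h with memL (x , false) t in x̄∈t
... | true = ≤M-evalTerm⇒≤M-evalLit c t v c≤t (memL⇒∈ (x , false) t x̄∈t)
... | false with c ≤M v x in c≤vx
...   | false = ≤M-negM c (v x) c<0 c≤vx

cutValuation-satisfies : (t : Term n) (c : M) (v : Fin n → M) → contradictory t ≡ false →
                         (c ≤M evalTerm t v) ≡ true → evalTermB t (cutValuation t c v) ≡ true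
cutValuation-satisfies t c v consistent c≤t = ∈⇒all _ t literal-true
  where
  literal-true : ∀ {l} → l ∈ t → evalLitB l (cutValuation t c v) ≡ true
  literal-true {x , true} x∈t with memL (x , false) t in x̄∈t
  ... | true  = ⊥-elim (not-¬ (∈⇒any _ t x∈t x̄∈t) consistent)
  ... | false = ≤M-evalTerm⇒≤M-evalLit c t v c≤t x∈t
  literal-true {x , false} x̄∈t rewrite ∈⇒memL t x̄∈t = refl

evalDNF-attained : (d : DNF n) (v : Fin n → M) →
                   evalDNF d v ≡ -∞ ⊎ ∃ λ t → t ∈ d × (evalDNF d v ≤M evalTerm t v) ≡ true
evalDNF-attained d v with any (λ t → evalDNF d v ≤M evalTerm t v) d in attained
... | true  = inj₂ (any⇒∃∈ _ d attained)
... | false = inj₁ (≤M--∞⇒≡-∞ a (trans (sym a≤a≡a≤-∞) (≤M-refl a)))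
  where
  a : M
  a = evalDNF d v
  a≤a≡a≤-∞ : (a ≤M a) ≡ (a ≤M -∞)
  a≤a≡a≤-∞ = trans (≤M-evalDNF a d v) (cong (_∨ (a ≤M -∞)) attained)

entails⇒evalDNF-≤M : (d e : DNF n) (v : Fin n → M) →
                     (∀ {t} → t ∈ d → contradictory t ≡ false) →
                     (∀ b → evalDNFB d b ≡ true → evalDNFB e b ≡ true) →
                     IsNeg (evalDNF d v) → (evalDNF d v ≤M evalDNF e v) ≡ true
entails⇒evalDNF-≤M {n} d e v consistent entails d<0 with evalDNF-attained d v
... | inj₁ d≡-∞ rewrite d≡-∞ = refl
... | inj₂ (t , t∈d , a≤t) =
  evalDNFB⇒≤M-evalDNF a e v b (cutValuation-literalsAbove t a v d<0 a≤t)
    (entails b (∈⇒any _ d t∈d (cutValuation-satisfies t a v (consistent t∈d) a≤t)))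
  where
  a : M
  a = evalDNF d v
  b : Fin n → Bool
  b = cutValuation t a v

canonicalImp-consistent : (φ : Expr n) {t : Term n} →
                          t ∈ canonicalImp φ → contradictory t ≡ false
canonicalImp-consistent φ t∈imp = not-injective (∈-filter⇒ _ (canonical φ) t∈imp)

sign-evalDNF-canonicalImp : (φ : Expr n) (v : Fin n → M) →
                            sign (evalDNF (canonicalImp φ) v) ≡ sign (⟦ φ ⟧M v)
sign-evalDNF-canonicalImp φ v = begin
  sign (evalDNF (canonicalImp φ) v)  ≡⟨ sign-evalDNF (canonicalImp φ) v ⟩
  evalDNFB (canonicalImp φ) (sign ∘ v) ≡⟨ evalDNFB-canonicalImp φ (sign ∘ v) ⟩
  ⟦ φ ⟧B (sign ∘ v)                  ≡⟨ sign-⟦⟧ φ v ⟨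
  sign (⟦ φ ⟧M v)                    ∎

canonicalImp-≤M : (φ ψ : Expr n) → B₂-equivalent φ ψ → (v : Fin n → M) → IsNeg (⟦ φ ⟧M v) →
                  (evalDNF (canonicalImp φ) v ≤M evalDNF (canonicalImp ψ) v) ≡ true
canonicalImp-≤M φ ψ φ≈ψ v φ<0 =
  entails⇒evalDNF-≤M (canonicalImp φ) (canonicalImp ψ) v (canonicalImp-consistent φ) entails
    (IsNeg-resp-sign (⟦ φ ⟧M v) (evalDNF (canonicalImp φ) v)
                     (sym (sign-evalDNF-canonicalImp φ v)) φ<0)
  where
  entails : ∀ b → evalDNFB (canonicalImp φ) b ≡ true → evalDNFB (canonicalImp ψ) b ≡ true
  entails b φ-true = begin
    evalDNFB (canonicalImp ψ) b  ≡⟨ evalDNFB-canonicalImp ψ b ⟩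
    ⟦ ψ ⟧B b                     ≡⟨ φ≈ψ b ⟨
    ⟦ φ ⟧B b                     ≡⟨ evalDNFB-canonicalImp φ b ⟨
    evalDNFB (canonicalImp φ) b  ≡⟨ φ-true ⟩
    true                         ∎

lemma3 : (n : ℕ) (φ ψ : Expr n) → B₂-equivalent φ ψ →
    (v : Fin n → M) → IsNeg (⟦ φ ⟧M v) →
    evalDNF (canonicalImp φ) v ≡ evalDNF (canonicalImp ψ) v
lemma3 n φ ψ φ≈ψ v φ<0 =
  ≤M-antisym _ _ (canonicalImp-≤M φ ψ φ≈ψ v φ<0) (canonicalImp-≤M ψ φ (sym ∘ φ≈ψ) v ψ<0)
  where
  ψ<0 : IsNeg (⟦ ψ ⟧M v)
  ψ<0 = IsNeg-resp-sign (⟦ φ ⟧M v) (⟦ ψ ⟧M v)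
          (trans (sign-⟦⟧ φ v) (trans (φ≈ψ (sign ∘ v)) (sym (sign-⟦⟧ ψ v)))) φ<0
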